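{- Let $\mathsf{L}$ be a description logic and $\mathcal{T}$ a stratified TBox. Let $\mathcal{T}_g=\emptyset$ and $\mathcal{T}_u=\{A\sqsubseteq D,\ \neg A\sqsubseteq\neg D\mid A\doteq D\in\mathcal{T}\}$. Then $(\mathcal{T}_u,\mathcal{T}_g)$ is a correct absorption of $\mathcal{T}$.
   Context: A description logic (DL) $\mathsf{L}$ is based on infinite sets $\mathsf{NC}$ of atomic concepts and $\mathsf{NR}$ of atomic roles; $\mathsf{L}$ is identified with its set of well-formed concepts, closed under boolean operations ($\sqcap,\sqcup,\neg$) and sub-concepts. $C\rightarrow D$ abbreviates $\neg C\sqcup D$, $C\leftrightarrow D$ abbreviates $(C\rightarrow D)\sqcap(D\rightarrow C)$. An interpretation is $\mathcal{I}=(\Delta^{\mathcal{I}},\cdot^{\mathcal{I}})$ with $\Delta^{\mathcal{I}}$ non-empty, $\cdot^{\mathcal{I}}$ mapping $\mathsf{NC}$ to $2^{\Delta^{\mathcal{I}}}$ and $\mathsf{NR}$ to $2^{\Delta^{\mathcal{I}}\times\Delta^{\mathcal{I}}}$. A set $\mathsf{Int}(\mathsf{L})$ of admissible interpretations is given, closed under isomorphism, such that for two interpretations agreeing on $\mathsf{NR}$, one is in $\mathsf{Int}(\mathsf{L})$ iff the other is. Every $\mathcal{I}\in\mathsf{Int}(\mathsf{L})$ extends to all concepts so that (I1) boolean combinations are interpreted set-theoretically, and (I2) $C^{\mathcal{I}}$ depends only on the interpretations of atomic concepts and roles occurring syntactically in $C$. For an interpretation $\mathcal{I}$, $A\in\mathsf{NC}$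 and $X\subseteq\Delta^{\mathcal{I}}$, $\mathcal{I}[A\mapsto X]$ denotes the interpretation mapping $A$ to $X$ and agreeing with $\mathcal{I}$ elsewhere. A TBox is a finite set of axioms $C_1\sqsubseteq C_2$ or $C_1\doteq C_2$; $A\in\mathsf{NC}$ is defined in $\mathcal{T}$ if $\mathcal{T}$ contains an axiom $A\sqsubseteq C$ or $A\doteq C$. $\mathcal{I}\in\mathsf{Int}(\mathsf{L})$ is a model ($\mathcal{I}\models\mathcal{T}$) iff $C_1^{\mathcal{I}}\subseteq C_2^{\mathcal{I}}$ (resp. $=$) for each axiom. $\mathcal{T}\equiv\mathcal{T}'$ iff they have the same models in $\mathsf{Int}(\mathsf{L})$. A concept $C$ is monotone in $A\in\mathsf{NC}$ if for every $\mathcal{I}\in\mathsf{Int}(\mathsf{L})$ and all $X_1\subseteq X_2\subseteq\Delta^{\mathcal{I}}$, $C^{\mathcal{I}[A\mapsto X_1]}\subseteq C^{\mathcal{I}[A\mapsto X_2]}$. A TBox $\mathcal{T}$ is stratified iff it consists only of axioms $A\doteq D$ with $A\in\mathsf{NC}$, each $A\in\mathsf{NC}$ appears at most once as a left-hand side, and there is a partition of $\mathcal{T}$ into disjoint $\mathcal{T}_1,\dots,\mathcal{T}_k$ such that: for all $1\le j<i\le k$, if $A$ is defined in $\mathcal{T}_i$ then $A$ does not occur in $\mathcal{T}_j$; and for every $i$, every right-hand side of an axiom in $\mathcal{T}_i$ is monotone in every atomic concept defined in $\mathcal{T}_i$. A witness for $C$ is $\mathcal{W}=(\Delta^{\mathcal{W}},\cdot^{\mathcal{W}},\mathcal{L}^{\mathcal{W}})$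 with $\Delta^{\mathcal{W}}$ non-empty, $\cdot^{\mathcal{W}}$ mapping $\mathsf{NR}$ to binary relations on $\Delta^{\mathcal{W}}$, $\mathcal{L}^{\mathcal{W}}:\Delta^{\mathcal{W}}\to2^{\mathsf{L}}$, such that (W1) some $x$ has $C\in\mathcal{L}^{\mathcal{W}}(x)$; (W2) some $\mathcal{I}\in\mathsf{Int}(\mathsf{L})$ stems from $\mathcal{W}$; (W3) every $\mathcal{I}\in\mathsf{Int}(\mathsf{L})$ stemming from $\mathcal{W}$ satisfies $D\in\mathcal{L}^{\mathcal{W}}(x)\Rightarrow x\in D^{\mathcal{I}}$. $\mathcal{I}$ stems from $\mathcal{W}$ if $\Delta^{\mathcal{I}}=\Delta^{\mathcal{W}}$, $\cdot^{\mathcal{I}}|_{\mathsf{NR}}=\cdot^{\mathcal{W}}$, and for all $A\in\mathsf{NC}$: $A\in\mathcal{L}^{\mathcal{W}}(x)\Rightarrow x\in A^{\mathcal{I}}$, $\neg A\in\mathcal{L}^{\mathcal{W}}(x)\Rightarrow x\notin A^{\mathcal{I}}$. $\mathcal{W}$ is admissible w.r.t. $\mathcal{T}$ if some $\mathcal{I}\in\mathsf{Int}(\mathsf{L})$ stemming from $\mathcal{W}$ satisfies $\mathcal{I}\models\mathcal{T}$. An absorption of $\mathcal{T}$ is a pair of TBoxes $(\mathcal{T}_u,\mathcal{T}_g)$ with $\mathcal{T}\equiv\mathcal{T}_u\cup\mathcal{T}_g$ where $\mathcal{T}_u$ contains only axioms $A\sqsubseteq D$ or $\neg A\sqsubseteq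 D$ with $A\in\mathsf{NC}$. A witness $\mathcal{W}$ is unfolded w.r.t. $(\mathcal{T}_u,\mathcal{T}_g)$ if for every $x\in\Delta^{\mathcal{W}}$: $A\sqsubseteq D\in\mathcal{T}_u$ and $A\in\mathcal{L}^{\mathcal{W}}(x)$ imply $D\in\mathcal{L}^{\mathcal{W}}(x)$; $\neg A\sqsubseteq D\in\mathcal{T}_u$ and $\neg A\in\mathcal{L}^{\mathcal{W}}(x)$ imply $D\in\mathcal{L}^{\mathcal{W}}(x)$; $C_1\sqsubseteq C_2\in\mathcal{T}_g$ implies $C_1\rightarrow C_2\in\mathcal{L}^{\mathcal{W}}(x)$; $C_1\doteq C_2\in\mathcal{T}_g$ implies $C_1\leftrightarrow C_2\in\mathcal{L}^{\mathcal{W}}(x)$. The absorption is correct if every witness (for any concept) that is unfolded w.r.t. $(\mathcal{T}_u,\mathcal{T}_g)$ is admissible w.r.t. $\mathcal{T}$. -}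

module Defs where

open import Level using (0ℓ)
open import Data.Bool using (Bool; true; false; _∧_; _∨_; not; if_then_else_)
open import Data.Nat using (ℕ)
open import Data.Fin using (Fin) renaming (_<_ to _<ᶠ_)
open import Data.Product using (Σ; Σ-syntax; ∃; ∃-syntax; _×_; _,_; proj₁; proj₂)
open import Data.Sum using (_⊎_)
open import Data.Empty using (⊥)
open import Data.List using (List; []; _∷_; _++_; map; concatMap)
open import Data.List.Membership.Propositional using (_∈_)
open import Data.List.Relation.Unary.All using (All)
open import Data.List.Relation.Unary.Any using (Any)
open import Relation.Binary.PropositionalEquality using (_≡_)
open import Relation.Binary.Definitions using (DecidableEquality)
open import Relation.Nullary using (¬_)
open import Relation.Nullary.Decidable using (⌊_⌋)
open import Function.Bundles using (_⇔_; _↔_; _↣_; Inverse)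
open import Function.Definitions using (Injective)

-- Subsets of a domain, classically 2^Δ, represented as Δ → Bool.

Subset : Set → Set
Subset Δ = Δ → Bool

_∈ˢ_ : {Δ : Set} → Δ → Subset Δ → Set
x ∈ˢ X = X x ≡ true

_⊆ˢ_ : {Δ : Set} → Subset Δ → Subset Δ → Set
X ⊆ˢ Y = ∀ x → x ∈ˢ X → x ∈ˢ Y

_≐ˢ_ : {Δ : Set} → Subset Δ → Subset Δ → Set
X ≐ˢ Y = ∀ x → X x ≡ Y x

record Interp (NC NR Δ : Set) : Set where
  field
    conc : NC → Subset Δ
    role : NR → Δ → Δ → Bool
open Interp public

record Iso {NC NR Δ₁ Δ₂ : Set} (I₁ : Interp NC NR Δ₁) (I₂ : Interp NC NR Δ₂) : Set where
  field
    bij       : Δ₁ ↔ Δ₂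
    conc-pres : ∀ A x → conc I₁ A x ≡ conc I₂ A (Inverse.to bij x)
    role-pres : ∀ r x y → role I₁ r x y ≡ role I₂ r (Inverse.to bij x) (Inverse.to bij y)

AgreeNR : {NC NR Δ : Set} → Interp NC NR Δ → Interp NC NR Δ → Set
AgreeNR {NR = NR} {Δ} I J = ∀ (r : NR) (x y : Δ) → role I r x y ≡ role J r x y

record DL : Set₁ where
  infixr 7 _⊓_
  infixr 6 _⊔_
  field
    NC NR     : Set
    NC-infinite : ℕ ↣ NC
    NR-infinite : ℕ ↣ NR
    _≟NC_     : DecidableEquality NC
    -- concepts (L is identified with its set of concepts)
    Concept   : Set
    atom      : NC → Concept
    atom-inj  : Injective _≡_ _≡_ atom
    _⊓_ _⊔_   : Concept → Concept → Concept
    ¬ᶜ_       : Concept → Concept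
    occC      : NC → Concept → Set
    occR      : NR → Concept → Set
    occC-atom : ∀ A B → occC A (atom B) ⇔ (A ≡ B)
    occC-⊓    : ∀ A C D → occC A (C ⊓ D) ⇔ (occC A C ⊎ occC A D)
    occC-⊔    : ∀ A C D → occC A (C ⊔ D) ⇔ (occC A C ⊎ occC A D)
    occC-¬    : ∀ A C → occC A (¬ᶜ C) ⇔ occC A C
    occR-atom : ∀ r B → occR r (atom B) ⇔ ⊥
    occR-⊓    : ∀ r C D → occR r (C ⊓ D) ⇔ (occR r C ⊎ occR r D)
    occR-⊔    : ∀ r C D → occR r (C ⊔ D) ⇔ (occR r C ⊎ occR r D)
    occR-¬    : ∀ r C → occR r (¬ᶜ C) ⇔ occR r C
    Adm       : {Δ : Set} → Interp NC NR Δ → Set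
    adm-nonempty : {Δ : Set} (I : Interp NC NR Δ) → Adm I → Δ
    adm-iso   : {Δ₁ Δ₂ : Set} (I₁ : Interp NC NR Δ₁) (I₂ : Interp NC NR Δ₂) →
                Iso I₁ I₂ → Adm I₁ → Adm I₂
    adm-NR    : {Δ : Set} (I J : Interp NC NR Δ) → AgreeNR I J → Adm I → Adm J
    ext       : {Δ : Set} → Interp NC NR Δ → Concept → Subset Δ
    ext-atom  : {Δ : Set} (I : Interp NC NR Δ) → Adm I → ∀ A → ext I (atom A) ≐ˢ conc I A
    ext-⊓     : {Δ : Set} (I : Interp NC NR Δ) → Adm I → ∀ C D x →
                ext I (C ⊓ D) x ≡ (ext I C x ∧ ext I D x)
    ext-⊔     : {Δ : Set} (I : Interp NC NR Δ) → Adm I → ∀ C D x →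
                ext I (C ⊔ D) x ≡ (ext I C x ∨ ext I D x)
    ext-¬     : {Δ : Set} (I : Interp NC NR Δ) → Adm I → ∀ C x →
                ext I (¬ᶜ C) x ≡ not (ext I C x)
    ext-local : {Δ : Set} (I J : Interp NC NR Δ) → Adm I → Adm J → ∀ C →
                (∀ A → occC A C → conc I A ≐ˢ conc J A) →
                (∀ r → occR r C → ∀ x y → role I r x y ≡ role J r x y) →
                ext I C ≐ˢ ext J C

module _ (L : DL) where
  open DL L

  infixr 5 _⇒ᶜ_
  _⇒ᶜ_ : Concept → Concept → Concept
  C ⇒ᶜ D = (¬ᶜ C) ⊔ D

  _⇔ᶜ_ : Concept → Concept → Concept
  C ⇔ᶜ D = (C ⇒ᶜ D) ⊓ (D ⇒ᶜ C)

  update : {Δ : Set} → Interp NC NR Δ → NC → Subset Δ → Interp NC NR Δ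
  update I A X = record
    { conc = λ B → if ⌊ B ≟NC A ⌋ then X else conc I B
    ; role = role I }

  data Axiom : Set where
    _⊑_ : Concept → Concept → Axiom
    _≐_ : Concept → Concept → Axiom

  TBox : Set
  TBox = List Axiom

  Defined : NC → TBox → Set
  Defined A T = Σ Concept λ C → ((atom A ⊑ C) ∈ T) ⊎ ((atom A ≐ C) ∈ T)

  OccAx : NC → Axiom → Set
  OccAx A (C ⊑ D) = occC A C ⊎ occC A D
  OccAx A (C ≐ D) = occC A C ⊎ occC A D

  OccursIn : NC → TBox → Set
  OccursIn A T = Any (OccAx A) T

  Sat : {Δ : Set} → Interp NC NR Δ → Axiom → Set
  Sat I (C ⊑ D) = ext I C ⊆ˢ ext I D
  Sat I (C ≐ D) = ext I C ≐ˢ ext I D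

  Model : {Δ : Set} → Interp NC NR Δ → TBox → Set
  Model I T = Adm I × All (Sat I) T

  _≡T_ : TBox → TBox → Set₁
  T ≡T T' = ∀ {Δ : Set} (I : Interp NC NR Δ) → Model I T ⇔ Model I T'

  Monotone : Concept → NC → Set₁
  Monotone C A = ∀ {Δ : Set} (I : Interp NC NR Δ) → Adm I →
                 ∀ (X₁ X₂ : Subset Δ) → X₁ ⊆ˢ X₂ →
                 ext (update I A X₁) C ⊆ˢ ext (update I A X₂) C

  record Stratified (T : TBox) : Set₁ where
    field
      onlyDefs   : All (λ ax → Σ NC λ A → Σ Concept λ D → ax ≡ (atom A ≐ D)) T
      lhsOnce    : ∀ A D D' → (atom A ≐ D) ∈ T → (atom A ≐ D') ∈ T → D ≡ D'
      k          : ℕ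
      part       : Fin k → TBox
      part-cover : ∀ ax → (ax ∈ T) ⇔ (Σ (Fin k) λ i → ax ∈ part i)
      part-disj  : ∀ i j ax → ax ∈ part i → ax ∈ part j → i ≡ j
      part-order : ∀ i j → j <ᶠ i → ∀ A → Defined A (part i) → ¬ OccursIn A (part j)
      part-mono  : ∀ i A C D → (C ≐ D) ∈ part i → Defined A (part i) → Monotone D A

  record Witness : Set₁ where
    field
      Δʷ    : Set
      pointʷ : Δʷ
      roleʷ : NR → Δʷ → Δʷ → Bool
      label : Δʷ → Concept → Set

  StemsFrom : (W : Witness) → Interp NC NR (Witness.Δʷ W) → Set
  StemsFrom W I =
    (∀ r x y → role I r x y ≡ Witness.roleʷ W r x y) ×
    (∀ A x → Witness.label W x (atom A) → conc I A x ≡ true) ×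
    (∀ A x → Witness.label W x (¬ᶜ atom A) → conc I A x ≡ false)

  IsWitnessFor : Concept → Witness → Set
  IsWitnessFor C W =
    (Σ (Witness.Δʷ W) λ x → Witness.label W x C) ×
    (Σ (Interp NC NR (Witness.Δʷ W)) λ I → Adm I × StemsFrom W I) ×
    (∀ (I : Interp NC NR (Witness.Δʷ W)) → Adm I → StemsFrom W I →
       ∀ x D → Witness.label W x D → ext I D x ≡ true)

  AdmissibleW : Witness → TBox → Set
  AdmissibleW W T = Σ (Interp NC NR (Witness.Δʷ W)) λ I →
                      Adm I × StemsFrom W I × Model I T

  UnfoldableAxiom : Axiom → Set
  UnfoldableAxiom ax = Σ NC λ A → Σ Concept λ D →
                         (ax ≡ (atom A ⊑ D)) ⊎ (ax ≡ ((¬ᶜ atom A) ⊑ D))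

  IsAbsorption : TBox → TBox → TBox → Set₁
  IsAbsorption T Tu Tg = (T ≡T (Tu ++ Tg)) × All UnfoldableAxiom Tu

  Unfolded : Witness → TBox → TBox → Set
  Unfolded W Tu Tg = ∀ (x : Witness.Δʷ W) →
    (∀ A D → (atom A ⊑ D) ∈ Tu → Witness.label W x (atom A) → Witness.label W x D) ×
    (∀ A D → ((¬ᶜ atom A) ⊑ D) ∈ Tu → Witness.label W x (¬ᶜ atom A) → Witness.label W x D) ×
    (∀ C₁ C₂ → (C₁ ⊑ C₂) ∈ Tg → Witness.label W x (C₁ ⇒ᶜ C₂)) ×
    (∀ C₁ C₂ → (C₁ ≐ C₂) ∈ Tg → Witness.label W x (C₁ ⇔ᶜ C₂))

  CorrectAbsorption : TBox → TBox → TBox → Set₁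
  CorrectAbsorption T Tu Tg =
    IsAbsorption T Tu Tg ×
    (∀ (C : Concept) (W : Witness) → IsWitnessFor C W → Unfolded W Tu Tg → AdmissibleW W T)

  defsTBox : List (NC × Concept) → TBox
  defsTBox Ds = map (λ p → atom (proj₁ p) ≐ proj₂ p) Ds

  unfoldTBox : List (NC × Concept) → TBox
  unfoldTBox Ds = concatMap (λ p → (atom (proj₁ p) ⊑ proj₂ p) ∷ ((¬ᶜ atom (proj₁ p)) ⊑ (¬ᶜ proj₂ p)) ∷ []) Ds

{-# OPTIONS --safe #-}
-- A ≐ D holds exactly when A ⊑ D and ¬A ⊑ ¬D do, so T and T_u have the same
-- models. Given a witness unfolded w.r.t. T_u, a model of T stemming from it
-- is built stratum by stratum, starting from any interpretation stemming from
-- the witness. In the current stratum the defined atoms are reinterpreted by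
-- the least fixpoint of the monotone operator X ↦ (points labelled B) ∪ D_B[X];
-- positive labels hold by construction, negative ones because ¬B in a label
-- forces ¬D_B there, and the fixpoint equals D_B because a positive label B
-- forces the label D_B. Atoms defined in a stratum do not occur in earlier
-- strata, so those stay satisfied.
module Submission where

open import Defs
open import Level using (0ℓ)
open import Axiom.ExcludedMiddle using (ExcludedMiddle)
open import Data.Bool using (Bool; true; false; not; if_then_else_)
open import Data.Bool.Properties using (not-injective; ¬-not)
open import Data.Fin using (Fin; toℕ; fromℕ<)
open import Data.Fin.Properties using (toℕ-fromℕ<; toℕ-injective; toℕ<n)
open import Data.List using (List; []; _∷_; map; filter; _++_)
open import Data.List.Membership.Propositional using (_∈_; _∉_)
open import Data.List.Membership.Propositional.Properties
  using (∈-map⁺; ∈-map⁻; ∈-filter⁺; ∈-filter⁻)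
open import Data.List.Properties using (++-identityʳ)
open import Data.List.Relation.Unary.All as All using (All; []; _∷_)
open import Data.List.Relation.Unary.Any as Any using (here; there)
open import Data.Nat using (ℕ; zero; suc; _≤_; _<_)
open import Data.Nat.Properties using (<⇒≤; ≤-refl; m<1+n⇒m<n∨m≡n)
open import Data.Product using (Σ; _×_; _,_; proj₁; proj₂)
open import Data.Sum using (_⊎_; inj₁; inj₂)
open import Function using (_∘′_)
open import Function.Bundles using (_⇔_; mk⇔; Equivalence)
open import Relation.Unary using (Decidable)
open import Relation.Nullary using (¬_; yes; no; does; contradiction)
open import Relation.Nullary.Decidable using (dec-true; dec-false)
open import Relation.Binary.PropositionalEquality
  using (_≡_; refl; sym; trans; cong; subst; module ≡-Reasoning)

private variable
  Δ : Set

≡-by-true : {a b : Bool} → (a ≡ true → b ≡ true) → (b ≡ true → a ≡ true) → a ≡ b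
≡-by-true {true}  f g = sym (f refl)
≡-by-true {false} {true}  f g = g refl
≡-by-true {false} {false} f g = refl

≡-by-cases : {a b : Bool} → (a ≡ true → b ≡ true) → (a ≡ false → b ≡ false) → a ≡ b
≡-by-cases {true}  f g = sym (f refl)
≡-by-cases {false} f g = sym (g refl)

⊆ˢ-trans : {X Y Z : Subset Δ} → X ⊆ˢ Y → Y ⊆ˢ Z → X ⊆ˢ Z
⊆ˢ-trans X⊆Y Y⊆Z x = Y⊆Z x ∘′ X⊆Y x

≐ˢ⇒⊆ˢ : {X Y : Subset Δ} → X ≐ˢ Y → X ⊆ˢ Y
≐ˢ⇒⊆ˢ X≐Y x x∈X = trans (sym (X≐Y x)) x∈X

≐ˢ⇒⊇ˢ : {X Y : Subset Δ} → X ≐ˢ Y → Y ⊆ˢ X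
≐ˢ⇒⊇ˢ X≐Y x x∈Y = trans (X≐Y x) x∈Y

module Semantics (L : DL) where
  open DL L

  private variable
    I J : Interp NC NR Δ
    A B : NC
    C D : Concept
    X : Subset Δ
    x : Δ

  ext-cong : ∀ C → Adm I → Adm J → AgreeNR I J →
             (∀ A → occC A C → conc I A ≐ˢ conc J A) → ext I C ≐ˢ ext J C
  ext-cong {I = I} {J = J} C adm-I adm-J role-≡ conc-≐ =
    ext-local I J adm-I adm-J C conc-≐ (λ r _ → role-≡ r)

  ext-¬⁺ : Adm I → ext I C x ≡ false → ext I (¬ᶜ C) x ≡ true
  ext-¬⁺ {I = I} {C = C} {x = x} adm C∌x = trans (ext-¬ I adm C x) (cong not C∌x)

  ext-¬⁻ : Adm I → ext I (¬ᶜ C) x ≡ true → ext I C x ≡ false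
  ext-¬⁻ {I = I} {C = C} {x = x} adm ¬C∋x =
    not-injective {y = false} (trans (sym (ext-¬ I adm C x)) ¬C∋x)

  update-adm : ∀ A X → Adm I → Adm (update L I A X)
  update-adm {I = I} A X = adm-NR I (update L I A X) (λ _ _ _ → refl)

  update-self : (I : Interp NC NR Δ) → ∀ A B → conc (update L I A (conc I A)) B ≐ˢ conc I B
  update-self I A B x with B ≟NC A
  ... | yes refl = refl
  ... | no _     = refl

  ext-mono : (ℓ : List NC) → (∀ {A} → A ∈ ℓ → Monotone L C A) →
             Adm I → AgreeNR I J →
             (∀ A → conc I A ⊆ˢ conc J A) → (∀ A → A ∉ ℓ → conc I A ≐ˢ conc J A) →
             ext I C ⊆ˢ ext J C
  ext-mono {C = C} {I = I} {J = J} [] _ adm-I role-≡ _ conc-≐ =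
    ≐ˢ⇒⊆ˢ (ext-cong C adm-I (adm-NR I J role-≡ adm-I) role-≡ (λ A _ → conc-≐ A (λ ())))
  ext-mono {C = C} {I = I} {J = J} (a ∷ ℓ) mono adm-I role-≡ conc-⊆ conc-≐ =
    ⊆ˢ-trans unchanged (⊆ˢ-trans change-a change-rest)
    where
    K : Interp NC NR _
    K = update L I a (conc J a)

    unchanged : ext I C ⊆ˢ ext (update L I a (conc I a)) C
    unchanged = ≐ˢ⇒⊇ˢ (ext-cong C (update-adm a (conc I a) adm-I) adm-I
                                 (λ _ _ _ → refl) (λ B _ → update-self I a B))

    change-a : ext (update L I a (conc I a)) C ⊆ˢ ext K C
    change-a = mono (here refl) I adm-I (conc I a) (conc J a) (conc-⊆ a)

    K⊆J : ∀ A → conc K A ⊆ˢ conc J A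
    K⊆J A with A ≟NC a
    ... | yes refl = λ _ x∈ → x∈
    ... | no _     = conc-⊆ A

    K≐J : ∀ A → A ∉ ℓ → conc K A ≐ˢ conc J A
    K≐J A A∉ℓ with A ≟NC a
    ... | yes refl = λ _ → refl
    ... | no A≢a   = conc-≐ A (λ { (here A≡a) → A≢a A≡a ; (there A∈ℓ) → A∉ℓ A∈ℓ })

    change-rest : ext K C ⊆ˢ ext J C
    change-rest = ext-mono ℓ (mono ∘′ there) (update-adm a (conc J a) adm-I) role-≡ K⊆J K≐J

  Sat-local : ∀ ax → Adm I → Adm J → AgreeNR I J →
              (∀ A → OccAx L A ax → conc I A ≐ˢ conc J A) → Sat L J ax → Sat L I ax
  Sat-local (C ⊑ D) adm-I adm-J role-≡ conc-≐ J⊨ x x∈C =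
    trans (ext-cong D adm-I adm-J role-≡ (λ A → conc-≐ A ∘′ inj₂) x)
          (J⊨ x (trans (sym (ext-cong C adm-I adm-J role-≡ (λ A → conc-≐ A ∘′ inj₁) x)) x∈C))
  Sat-local (C ≐ D) adm-I adm-J role-≡ conc-≐ J⊨ x =
    trans (ext-cong C adm-I adm-J role-≡ (λ A → conc-≐ A ∘′ inj₁) x)
          (trans (J⊨ x) (sym (ext-cong D adm-I adm-J role-≡ (λ A → conc-≐ A ∘′ inj₂) x)))

  Sat-≐⇔ : Adm I → ∀ C D → Sat L I (C ≐ D) ⇔ (Sat L I (C ⊑ D) × Sat L I ((¬ᶜ C) ⊑ (¬ᶜ D)))
  Sat-≐⇔ adm C D = mk⇔
    (λ C≐D → ≐ˢ⇒⊆ˢ C≐D , λ x ¬C∋x → ext-¬⁺ adm (trans (sym (C≐D x)) (ext-¬⁻ adm ¬C∋x)))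
    (λ (C⊆D , ¬C⊆¬D) x → ≡-by-cases (C⊆D x) (λ C∌x → ext-¬⁻ adm (¬C⊆¬D x (ext-¬⁺ adm C∌x))))

  labels-consistent : (W : Witness L) {I : Interp NC NR (Witness.Δʷ W)} → StemsFrom L W I → ∀ A x →
                      Witness.label W x (atom A) → ¬ Witness.label W x (¬ᶜ atom A)
  labels-consistent W (_ , pos , neg) A x A∈ ¬A∈ with () ← trans (sym (pos A x A∈)) (neg A x ¬A∈)

  LabelsSound : Witness L → Set
  LabelsSound W = ∀ I → Adm I → StemsFrom L W I →
                  ∀ x D → Witness.label W x D → ext I D x ≡ true

module Unfolding (L : DL) where
  open DL L
  open Semantics L
  open Equivalence using (to; from)

  private variable
    Ds : List (NC × Concept)
    B : NC
    C D : Concept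

  ≐-injective : ∀ {C D C′ D′} → _≐_ {L} C D ≡ (C′ ≐ D′) → C ≡ C′ × D ≡ D′
  ≐-injective refl = refl , refl

  ∈-defsTBox⁻ : (atom B ≐ D) ∈ defsTBox L Ds → (B , D) ∈ Ds
  ∈-defsTBox⁻ B≐D∈ with ∈-map⁻ _ B≐D∈
  ... | _ , B′D′∈ , eq with ≐-injective eq
  ... | B≡B′ , refl rewrite atom-inj B≡B′ = B′D′∈

  ∈-unfoldTBox⁺ : (B , D) ∈ Ds → (atom B ⊑ D) ∈ unfoldTBox L Ds
  ∈-unfoldTBox⁺ (here refl) = here refl
  ∈-unfoldTBox⁺ (there BD∈) = there (there (∈-unfoldTBox⁺ BD∈))

  ∈-unfoldTBox⁻ : (B , D) ∈ Ds → ((¬ᶜ atom B) ⊑ (¬ᶜ D)) ∈ unfoldTBox L Ds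
  ∈-unfoldTBox⁻ (here refl) = there (here refl)
  ∈-unfoldTBox⁻ (there BD∈) = there (there (∈-unfoldTBox⁻ BD∈))

  unfoldTBox-unfoldable : ∀ Ds → All (UnfoldableAxiom L) (unfoldTBox L Ds)
  unfoldTBox-unfoldable [] = []
  unfoldTBox-unfoldable ((A , D) ∷ Ds) =
    (A , D , inj₁ refl) ∷ (A , ¬ᶜ D , inj₂ refl) ∷ unfoldTBox-unfoldable Ds

  defsTBox⇔unfoldTBox : ∀ {Δ} {I : Interp NC NR Δ} → Adm I → ∀ Ds →
                        All (Sat L I) (defsTBox L Ds) ⇔ All (Sat L I) (unfoldTBox L Ds)
  defsTBox⇔unfoldTBox adm [] = mk⇔ (λ _ → []) (λ _ → [])
  defsTBox⇔unfoldTBox adm ((A , D) ∷ Ds) = mk⇔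
    (λ { (A≐D ∷ rest) → let A⊑D , ¬A⊑¬D = to (Sat-≐⇔ adm (atom A) D) A≐D
                         in A⊑D ∷ ¬A⊑¬D ∷ to IH rest })
    (λ { (A⊑D ∷ ¬A⊑¬D ∷ rest) → from (Sat-≐⇔ adm (atom A) D) (A⊑D , ¬A⊑¬D) ∷ from IH rest })
    where IH = defsTBox⇔unfoldTBox adm Ds

  unfoldTBox-isAbsorption : ∀ Ds → IsAbsorption L (defsTBox L Ds) (unfoldTBox L Ds) []
  unfoldTBox-isAbsorption Ds = models-≡ , unfoldTBox-unfoldable Ds
    where
    models-≡ : _≡T_ L (defsTBox L Ds) (unfoldTBox L Ds ++ [])
    models-≡ I rewrite ++-identityʳ (unfoldTBox L Ds) = mk⇔
      (λ (adm , sat) → adm , to (defsTBox⇔unfoldTBox adm Ds) sat)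
      (λ (adm , sat) → adm , from (defsTBox⇔unfoldTBox adm Ds) sat)

module Classical (lem : ExcludedMiddle 0ℓ) where

  ⟦_⟧ : Set → Bool
  ⟦ P ⟧ = does (lem {P})

  ⟦⟧-sound : ∀ {P} → ⟦ P ⟧ ≡ true → P
  ⟦⟧-sound {P} ⟦P⟧≡true with lem {P}
  ... | yes P-holds = P-holds

  ⟦⟧-complete : ∀ {P} → P → ⟦ P ⟧ ≡ true
  ⟦⟧-complete = dec-true lem

  ⟦⟧-refute : ∀ {P} → ¬ P → ⟦ P ⟧ ≡ false
  ⟦⟧-refute = dec-false lem

  -- Knaster–Tarski; excluded middle makes the intersection of all
  -- pre-fixpoints a Boolean-valued subset.
  module LeastFixpoint {Idx : Set} (F : Subset Idx → Idx → Set)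
                       (F-mono : ∀ {X Y} → X ⊆ˢ Y → ∀ i → F X i → F Y i) where

    PreFixpoint : Subset Idx → Set
    PreFixpoint X = ∀ i → F X i → i ∈ˢ X

    lfp : Subset Idx
    lfp i = ⟦ (∀ X → PreFixpoint X → i ∈ˢ X) ⟧

    lfp-least : ∀ {X} → PreFixpoint X → lfp ⊆ˢ X
    lfp-least pre i i∈lfp = ⟦⟧-sound i∈lfp _ pre

    lfp-prefixpoint : PreFixpoint lfp
    lfp-prefixpoint i Fi = ⟦⟧-complete (λ X pre → pre i (F-mono (lfp-least pre) i Fi))

    lfp-unfold : ∀ i → i ∈ˢ lfp → F lfp i
    lfp-unfold i i∈lfp = ⟦⟧-sound (lfp-least F-lfp-prefixpoint i i∈lfp)
      where
      F-lfp-prefixpoint : PreFixpoint (λ j → ⟦ F lfp j ⟧)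
      F-lfp-prefixpoint j Fj = ⟦⟧-complete (F-mono (λ k → lfp-prefixpoint k ∘′ ⟦⟧-sound) j Fj)

  module _ (L : DL) (W : Witness L) where
    open DL L
    open Semantics L
    open Witness W

    module Stratum (Def : NC → Concept → Set)
             (Def-functional : ∀ {B D D′} → Def B D → Def B D′ → D ≡ D′)
             (Def-monotone : ∀ {A C B D} → Def A C → Def B D → Monotone L D A)
             (atoms : List NC) (atoms-complete : ∀ {B D} → Def B D → B ∈ atoms)
             (unfold⁺ : ∀ {B D} x → Def B D → label x (atom B) → label x D)
             (unfold⁻ : ∀ {B D} x → Def B D → label x (¬ᶜ atom B) → label x (¬ᶜ D))
             (sound : LabelsSound W)
             (I : Interp NC NR Δʷ) (adm : Adm I) (stems : StemsFrom L W I) where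

      Defines : NC → Set
      Defines B = Σ Concept (Def B)

      defined? : Decidable Defines
      defined? B = lem

      redefine : Subset (NC × Δʷ) → Interp NC NR Δʷ
      redefine X = record
        { conc = λ B x → if ⟦ Defines B ⟧ then X (B , x) else conc I B x
        ; role = role I }

      redefine-adm : ∀ X → Adm (redefine X)
      redefine-adm X = adm-NR I (redefine X) (λ _ _ _ → refl) adm

      redefine-defined : ∀ X {B} → Defines B → ∀ x → conc (redefine X) B x ≡ X (B , x)
      redefine-defined X {B} B-defined x with lem {Defines B}
      ... | yes _           = refl
      ... | no B-undefined = contradiction B-defined B-undefined

      redefine-undefined : ∀ X {B} → ¬ Defines B → conc (redefine X) B ≐ˢ conc I B
      redefine-undefined X {B} B-undefined x with lem {Defines B}
      ... | yes B-defined = contradiction B-defined B-undefined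
      ... | no _          = refl

      redefine-stems : ∀ X → (∀ {B} x → label x (atom B) → X (B , x) ≡ true) →
                       (∀ {B} x → label x (¬ᶜ atom B) → X (B , x) ≡ false) →
                       StemsFrom L W (redefine X)
      redefine-stems X pos neg = proj₁ stems , pos′ , neg′
        where
        pos′ : ∀ B x → label x (atom B) → conc (redefine X) B x ≡ true
        pos′ B x B∈ with lem {Defines B}
        ... | yes _ = pos x B∈
        ... | no _  = proj₁ (proj₂ stems) B x B∈
        neg′ : ∀ B x → label x (¬ᶜ atom B) → conc (redefine X) B x ≡ false
        neg′ B x ¬B∈ with lem {Defines B}
        ... | yes _ = neg x ¬B∈
        ... | no _  = proj₂ (proj₂ stems) B x ¬B∈

      redefine-mono : ∀ {B D X Y} → Def B D → X ⊆ˢ Y → ext (redefine X) D ⊆ˢ ext (redefine Y) D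
      redefine-mono {B} {D} {X} {Y} B≐D X⊆Y =
        ext-mono definedAtoms monotone (redefine-adm X) (λ _ _ _ → refl) conc-⊆ conc-≐
        where
        definedAtoms : List NC
        definedAtoms = filter defined? atoms

        monotone : ∀ {A} → A ∈ definedAtoms → Monotone L D A
        monotone A∈ = Def-monotone (proj₂ (proj₂ (∈-filter⁻ defined? {xs = atoms} A∈))) B≐D

        conc-⊆ : ∀ A → conc (redefine X) A ⊆ˢ conc (redefine Y) A
        conc-⊆ A x with lem {Defines A}
        ... | yes _ = X⊆Y (A , x)
        ... | no _  = λ x∈ → x∈

        conc-≐ : ∀ A → A ∉ definedAtoms → conc (redefine X) A ≐ˢ conc (redefine Y) A
        conc-≐ A A∉ x =
          trans (redefine-undefined X A-undefined x) (sym (redefine-undefined Y A-undefined x))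
          where
          A-undefined : ¬ Defines A
          A-undefined (C , A≐C) = A∉ (∈-filter⁺ defined? (atoms-complete A≐C) (C , A≐C))

      Forced : Subset (NC × Δʷ) → NC × Δʷ → Set
      Forced X (B , x) = label x (atom B) ⊎ Σ Concept λ D → Def B D × ext (redefine X) D x ≡ true

      Forced-mono : ∀ {X Y} → X ⊆ˢ Y → ∀ i → Forced X i → Forced Y i
      Forced-mono X⊆Y _       (inj₁ B∈)               = inj₁ B∈
      Forced-mono X⊆Y (B , x) (inj₂ (D , B≐D , D∋x)) = inj₂ (D , B≐D , redefine-mono B≐D X⊆Y x D∋x)

      open LeastFixpoint Forced Forced-mono

      unrefuted : Subset (NC × Δʷ)
      unrefuted (B , x) = ⟦ ¬ label x (¬ᶜ atom B) ⟧

      unrefuted-stems : StemsFrom L W (redefine unrefuted)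
      unrefuted-stems = redefine-stems unrefuted
        (λ x B∈ → ⟦⟧-complete (labels-consistent W stems _ x B∈))
        (λ x ¬B∈ → ⟦⟧-refute (λ B∉ → B∉ ¬B∈))

      -- If ¬B labels x, unfolding puts ¬D in the label of x, so D is false at x
      -- in every interpretation stemming from W and x cannot be forced into B.
      unrefuted-prefixpoint : PreFixpoint unrefuted
      unrefuted-prefixpoint (B , x) (inj₁ B∈) = ⟦⟧-complete (labels-consistent W stems B x B∈)
      unrefuted-prefixpoint (B , x) (inj₂ (D , B≐D , D∋x)) = ⟦⟧-complete λ ¬B∈ →
        contradiction (trans (sym D∋x) (ext-¬⁻ (redefine-adm unrefuted) (¬D∋x ¬B∈))) λ ()
        where
        ¬D∋x : label x (¬ᶜ atom B) → ext (redefine unrefuted) (¬ᶜ D) x ≡ true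
        ¬D∋x ¬B∈ = sound _ (redefine-adm unrefuted) unrefuted-stems x (¬ᶜ D) (unfold⁻ x B≐D ¬B∈)

      lfp-negative : ∀ {B} x → label x (¬ᶜ atom B) → lfp (B , x) ≡ false
      lfp-negative {B} x ¬B∈ =
        ¬-not (λ B∋x → ⟦⟧-sound (lfp-least unrefuted-prefixpoint (B , x) B∋x) ¬B∈)

      model : Interp NC NR Δʷ
      model = redefine lfp

      model-adm : Adm model
      model-adm = redefine-adm lfp

      model-stems : StemsFrom L W model
      model-stems = redefine-stems lfp (λ x B∈ → lfp-prefixpoint _ (inj₁ B∈)) lfp-negative

      model-agrees : ∀ {B} → ¬ Defines B → conc model B ≐ˢ conc I B
      model-agrees = redefine-undefined lfp

      model-fixpoint : ∀ {B D} → Def B D → Sat L model (atom B ≐ D)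
      model-fixpoint {B} {D} B≐D x = begin
        ext model (atom B) x  ≡⟨ ext-atom model model-adm B x ⟩
        conc model B x        ≡⟨ redefine-defined lfp (D , B≐D) x ⟩
        lfp (B , x)           ≡⟨ ≡-by-true unfold fold ⟩
        ext model D x         ∎
        where
        open ≡-Reasoning
        fold : ext model D x ≡ true → lfp (B , x) ≡ true
        fold D∋x = lfp-prefixpoint (B , x) (inj₂ (D , B≐D , D∋x))
        unfold : lfp (B , x) ≡ true → ext model D x ≡ true
        unfold B∋x with lfp-unfold (B , x) B∋x
        ... | inj₁ B∈                  = sound model model-adm model-stems x D (unfold⁺ x B≐D B∈)
        ... | inj₂ (D′ , B≐D′ , D′∋x) =
          subst (λ E → ext model E x ≡ true) (Def-functional B≐D′ B≐D) D′∋x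

module Correctness (lem : ExcludedMiddle 0ℓ) (L : DL) (Ds : List (DL.NC L × DL.Concept L))
                   (stratified : Stratified L (defsTBox L Ds)) where
  open DL L
  open Semantics L
  open Unfolding L
  open Classical lem
  open Stratified stratified
  open Equivalence using (to; from)

  private variable
    j : Fin k
    B : NC
    D D′ : Concept

  T : TBox L
  T = defsTBox L Ds

  Def : Fin k → NC → Concept → Set
  Def j B D = (atom B ≐ D) ∈ part j

  part⊆T : ∀ {ax} → ax ∈ part j → ax ∈ T
  part⊆T {j} {ax} ax∈ = from (part-cover ax) (j , ax∈)

  Def⇒∈Ds : Def j B D → (B , D) ∈ Ds
  Def⇒∈Ds = ∈-defsTBox⁻ ∘′ part⊆T

  Def-functional : Def j B D → Def j B D′ → D ≡ D′
  Def-functional B≐D B≐D′ = lhsOnce _ _ _ (part⊆T B≐D) (part⊆T B≐D′)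

  Def-monotone : ∀ {A C} → Def j A C → Def j B D → Monotone L D A
  Def-monotone {j} {C = C} A≐C B≐D = part-mono j _ _ _ B≐D (C , inj₂ A≐C)

  Def⇒∈atoms : Def j B D → B ∈ map proj₁ Ds
  Def⇒∈atoms = ∈-map⁺ proj₁ ∘′ Def⇒∈Ds

  SatisfiesBelow : ℕ → Interp NC NR Δ → Set
  SatisfiesBelow n I = ∀ j → toℕ j < n → All (Sat L I) (part j)

  module _ {C : Concept} (W : Witness L) (witness : IsWitnessFor L C W)
           (unfolded : Unfolded L W (unfoldTBox L Ds) []) where
    open Witness W

    unfold⁺ : ∀ x → Def j B D → label x (atom B) → label x D
    unfold⁺ x B≐D = proj₁ (unfolded x) _ _ (∈-unfoldTBox⁺ (Def⇒∈Ds B≐D))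

    unfold⁻ : ∀ x → Def j B D → label x (¬ᶜ atom B) → label x (¬ᶜ D)
    unfold⁻ x B≐D = proj₁ (proj₂ (unfolded x)) _ _ (∈-unfoldTBox⁻ (Def⇒∈Ds B≐D))

    models-below : ∀ n → n ≤ k →
                   Σ (Interp NC NR Δʷ) λ I → Adm I × StemsFrom L W I × SatisfiesBelow n I
    models-below zero _ =
      let I , adm , stems = proj₁ (proj₂ witness) in I , adm , stems , λ _ ()
    models-below (suc n) n<k with models-below n (<⇒≤ n<k)
    ... | I , adm , stems , sat = model , model-adm , model-stems , satisfies
      where
      i : Fin k
      i = fromℕ< n<k
      open Stratum L W (Def i) Def-functional Def-monotone (map proj₁ Ds) Def⇒∈atoms
                   unfold⁺ unfold⁻ (proj₂ (proj₂ witness)) I adm stems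

      current : All (Sat L model) (part i)
      current = All.tabulate defining
        where
        defining : ∀ {ax} → ax ∈ part i → Sat L model ax
        defining ax∈ with All.lookup onlyDefs (part⊆T ax∈)
        ... | _ , _ , refl = model-fixpoint ax∈

      earlier : ∀ j → toℕ j < n → All (Sat L model) (part j)
      earlier j j<n = All.tabulate λ {ax} ax∈ →
        Sat-local ax model-adm adm (λ _ _ _ → refl)
          (λ A A∈ax → model-agrees λ (D , A≐D) →
             part-order i j j<i A (D , inj₂ A≐D) (Any.map (λ { refl → A∈ax }) ax∈))
          (All.lookup (sat j j<n) ax∈)
        where
        j<i : toℕ j < toℕ i
        j<i = subst (toℕ j <_) (sym (toℕ-fromℕ< n<k)) j<n

      satisfies : SatisfiesBelow (suc n) model
      satisfies j j<1+n with m<1+n⇒m<n∨m≡n j<1+n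
      ... | inj₁ j<n = earlier j j<n
      ... | inj₂ j≡n rewrite toℕ-injective (trans j≡n (sym (toℕ-fromℕ< n<k))) = current

    admissible : AdmissibleW L W T
    admissible with models-below k ≤-refl
    ... | I , adm , stems , sat = I , adm , stems , adm , All.tabulate λ {ax} ax∈ →
      let j , ax∈j = to (part-cover ax) ax∈ in All.lookup (sat j (toℕ<n j)) ax∈j

mainTheorem8 : ExcludedMiddle 0ℓ → (L : DL) → (Ds : List (DL.NC L × DL.Concept L)) →
               Stratified L (defsTBox L Ds) →
               CorrectAbsorption L (defsTBox L Ds) (unfoldTBox L Ds) []
mainTheorem8 lem L Ds stratified =
  Unfolding.unfoldTBox-isAbsorption L Ds ,
  λ _ W witness unfolded → Correctness.admissible lem L Ds stratified W witness unfolded
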